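{- Let $G$ be a graph, $k\ge1$, and $S,T$ independent sets of $G$ of size $k$. Let $\mathcal{F}$ be obtained from an independence covering family for $(G,k)$ by removing all sets of size less than $k$ and adding $S$ and $T$. Let $\mathcal{G}$ be the graph with one vertex for each member of $\mathcal{F}$, where the vertices of $I,I'\in\mathcal{F}$ are adjacent iff $|I\cap I'|\ge k-1$, and let $i_s,i_t$ be the vertices of $S$ and $T$. If there is a sequence of token jumps $S=I_0,I_1,\dots,I_\ell=T$ in $G$, then there is a path from $i_s$ to $i_t$ in $\mathcal{G}$.
   Context: An independence covering family for $(G,k)$ is a family of independent sets of $G$ such that every independent set of size at most $k$ is contained in some member. A token jump transforms an independent set $I$ into $(I\setminus\{u\})\cup\{w\}$ with $u\in I$, $w\in V(G)\setminus I$, and the result independent. -}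

module Defs where

open import Data.Nat using (ℕ; _≤_; _∸_)
open import Data.Fin using (Fin)
open import Data.Fin.Subset using (Subset; _∈_; _∉_; _⊆_; _∩_; _∪_; _-_; ⁅_⁆; ∣_∣)
open import Data.Product using (Σ; _×_; ∃)
open import Data.Sum using (_⊎_)
open import Relation.Nullary using (¬_)
open import Relation.Binary.PropositionalEquality using (_≡_)
open import Relation.Binary.Construct.Closure.ReflexiveTransitive using (Star)

record Graph (n : ℕ) : Set₁ where
  field
    Adj   : Fin n → Fin n → Set
    sym   : ∀ {u v} → Adj u v → Adj v u
    irrefl : ∀ {u} → ¬ Adj u u

module _ {n : ℕ} (G : Graph n) where
  open Graph G

  Independent : Subset n → Set
  Independent I = ∀ {u v} → u ∈ I → v ∈ I → ¬ Adj u v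

  IsIndepCoveringFamily : ℕ → (Subset n → Set) → Set
  IsIndepCoveringFamily k 𝓕 =
    (∀ {I} → 𝓕 I → Independent I) ×
    (∀ J → Independent J → ∣ J ∣ ≤ k → ∃ λ I → 𝓕 I × J ⊆ I)

  TokenJump : Subset n → Subset n → Set
  TokenJump I J =
    Σ (Fin n) λ u → Σ (Fin n) λ w →
      u ∈ I × w ∉ I × J ≡ (I - u) ∪ ⁅ w ⁆ × Independent J

PrunedFamily : ∀ {n} → ℕ → (Subset n → Set) → Subset n → Subset n → Subset n → Set
PrunedFamily k 𝓕 S T X = (𝓕 X × k ≤ ∣ X ∣) ⊎ (X ≡ S ⊎ X ≡ T)

AuxAdj : ∀ {n} → ℕ → (Subset n → Set) → Subset n → Subset n → Set
AuxAdj k 𝓕 I I′ = 𝓕 I × 𝓕 I′ × (k ∸ 1) ≤ ∣ I ∩ I′ ∣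

AuxPath : ∀ {n} → ℕ → (Subset n → Set) → Subset n → Subset n → Set
AuxPath k 𝓕 = Star (AuxAdj k 𝓕)

-- Follow the token-jump sequence S = I₀, I₁, …, I_ℓ = T and replace every
-- intermediate Iⱼ (an independent set of size k) by a member Xⱼ ⊇ Iⱼ of the
-- pruned family, with X₀ = S. Consecutive sets of a token jump share k − 1
-- elements, and these survive in Xⱼ ∩ Xⱼ₊₁, so X₀, X₁, …, X_ℓ, T is a path in 𝒢;
-- the last step is an edge because T ⊆ X_ℓ.
module Submission where

open import Defs
open import Data.Nat using (ℕ; suc; _≤_; _∸_)
open import Data.Nat.Properties using (≤-trans; ≤-reflexive; m∸n≤m)
open import Data.Fin using (Fin; zero; suc)
open import Data.Fin.Subset using (Subset; inside; outside; ∣_∣; _∈_; _∉_; _⊆_; _∩_; _∪_; _-_; ⁅_⁆)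
open import Data.Fin.Subset.Properties
  using (p⊆q⇒∣p∣≤∣q∣; x∈p∩q⁺; x∈p∩q⁻; p─q⊆p; p─⊥≡p; ∪-identityʳ; p⊆p∪q)
open import Data.Vec using (_∷_; here; there)
open import Data.Product using (∃; _×_; _,_)
open import Data.Sum using (inj₁; inj₂)
open import Relation.Binary.PropositionalEquality using (_≡_; refl; cong; trans; subst)
open import Relation.Binary.Construct.Closure.ReflexiveTransitive using (Star; ε; _◅_)
open import Relation.Nullary using (contradiction)

∣p-x∣+1≡∣p∣ : ∀ {n} (p : Subset n) {x : Fin n} → x ∈ p → suc ∣ p - x ∣ ≡ ∣ p ∣
∣p-x∣+1≡∣p∣ (inside ∷ p) here = cong (λ q → suc ∣ q ∣) (p─⊥≡p p)
∣p-x∣+1≡∣p∣ (inside ∷ p) (there x∈p) = cong suc (∣p-x∣+1≡∣p∣ p x∈p)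
∣p-x∣+1≡∣p∣ (outside ∷ p) (there x∈p) = ∣p-x∣+1≡∣p∣ p x∈p

∣p∪⁅x⁆∣≡∣p∣+1 : ∀ {n} (p : Subset n) {x : Fin n} → x ∉ p → ∣ p ∪ ⁅ x ⁆ ∣ ≡ suc ∣ p ∣
∣p∪⁅x⁆∣≡∣p∣+1 (inside ∷ p) {zero} x∉p = contradiction here x∉p
∣p∪⁅x⁆∣≡∣p∣+1 (outside ∷ p) {zero} x∉p = cong (λ q → suc ∣ q ∣) (∪-identityʳ p)
∣p∪⁅x⁆∣≡∣p∣+1 (inside ∷ p) {suc x} x∉p = cong suc (∣p∪⁅x⁆∣≡∣p∣+1 p (λ x∈p → x∉p (there x∈p)))
∣p∪⁅x⁆∣≡∣p∣+1 (outside ∷ p) {suc x} x∉p = ∣p∪⁅x⁆∣≡∣p∣+1 p (λ x∈p → x∉p (there x∈p))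

∩-mono-⊆ : ∀ {n} {p q r s : Subset n} → p ⊆ r → q ⊆ s → p ∩ q ⊆ r ∩ s
∩-mono-⊆ {p = p} p⊆r q⊆s x∈p∩q with x∈p∩q⁻ p _ x∈p∩q
... | x∈p , x∈q = x∈p∩q⁺ (p⊆r x∈p , q⊆s x∈q)

module _ {n} (G : Graph n) where

  tokenJump-preserves-∣∣ : ∀ {I J} → TokenJump G I J → ∣ J ∣ ≡ ∣ I ∣
  tokenJump-preserves-∣∣ {I} (u , w , u∈I , w∉I , refl , _) =
    trans (∣p∪⁅x⁆∣≡∣p∣+1 (I - u) (λ w∈I-u → w∉I (p─q⊆p I _ w∈I-u))) (∣p-x∣+1≡∣p∣ I u∈I)

  tokenJump-overlap : ∀ {I J} → TokenJump G I J → ∣ I ∣ ∸ 1 ≤ ∣ I ∩ J ∣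
  tokenJump-overlap {I} (u , w , u∈I , _ , refl , _) =
    subst (_≤ ∣ I ∩ ((I - u) ∪ ⁅ w ⁆) ∣) (cong (_∸ 1) (∣p-x∣+1≡∣p∣ I u∈I)) (p⊆q⇒∣p∣≤∣q∣ I-u⊆I∩J)
    where
    I-u⊆I∩J : I - u ⊆ I ∩ ((I - u) ∪ ⁅ w ⁆)
    I-u⊆I∩J x∈I-u = x∈p∩q⁺ (p─q⊆p I _ x∈I-u , p⊆p∪q ⁅ w ⁆ x∈I-u)

  tokenJump-overlap-⊆ : ∀ {I J X Y} → TokenJump G I J → I ⊆ X → J ⊆ Y → ∣ I ∣ ∸ 1 ≤ ∣ X ∩ Y ∣
  tokenJump-overlap-⊆ jump I⊆X J⊆Y =
    ≤-trans (tokenJump-overlap jump) (p⊆q⇒∣p∣≤∣q∣ (∩-mono-⊆ I⊆X J⊆Y))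

  module _ (k : ℕ) (𝓗 : Subset n → Set)
           (cover : ∀ J → Independent G J → ∣ J ∣ ≡ k → ∃ λ X → 𝓗 X × J ⊆ X) where

    tokenJumps⇒auxPath : ∀ {I X T} → ∣ I ∣ ≡ k → 𝓗 X → I ⊆ X → 𝓗 T →
                         Star (TokenJump G) I T → AuxPath k 𝓗 X T
    tokenJumps⇒auxPath {I} {X} ∣I∣≡k 𝓗X I⊆X 𝓗T ε = (𝓗X , 𝓗T , edge) ◅ ε
      where
      edge : k ∸ 1 ≤ ∣ X ∩ I ∣
      edge = ≤-trans (m∸n≤m k 1)
        (subst (_≤ ∣ X ∩ I ∣) ∣I∣≡k (p⊆q⇒∣p∣≤∣q∣ (λ x∈I → x∈p∩q⁺ (I⊆X x∈I , x∈I))))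
    tokenJumps⇒auxPath ∣I∣≡k 𝓗X I⊆X 𝓗T (jump@(_ , _ , _ , _ , _ , indJ) ◅ jumps)
      with ∣J∣≡k ← trans (tokenJump-preserves-∣∣ jump) ∣I∣≡k
      with Y , 𝓗Y , J⊆Y ← cover _ indJ ∣J∣≡k =
      (𝓗X , 𝓗Y , subst (λ m → m ∸ 1 ≤ _) ∣I∣≡k (tokenJump-overlap-⊆ jump I⊆X J⊆Y))
        ◅ tokenJumps⇒auxPath ∣J∣≡k 𝓗Y J⊆Y 𝓗T jumps

prunedFamily-covers : ∀ {n} (G : Graph n) (k : ℕ) (S T : Subset n) (𝓕 : Subset n → Set) →
                      IsIndepCoveringFamily G k 𝓕 →
                      ∀ J → Independent G J → ∣ J ∣ ≡ k →
                      ∃ λ X → PrunedFamily k 𝓕 S T X × J ⊆ X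
prunedFamily-covers G k S T 𝓕 (_ , cover) J indJ ∣J∣≡k
  with X , 𝓕X , J⊆X ← cover J indJ (≤-reflexive ∣J∣≡k) =
  X , inj₁ (𝓕X , subst (_≤ ∣ X ∣) ∣J∣≡k (p⊆q⇒∣p∣≤∣q∣ J⊆X)) , J⊆X

lemma7p2 : ∀ {n} (G : Graph n) (k : ℕ) → 1 ≤ k →
           (S T : Subset n) → Independent G S → Independent G T →
           ∣ S ∣ ≡ k → ∣ T ∣ ≡ k →
           (𝓕 : Subset n → Set) → IsIndepCoveringFamily G k 𝓕 →
           Star (TokenJump G) S T →
           AuxPath k (PrunedFamily k 𝓕 S T) S T
lemma7p2 G k _ S T _ _ ∣S∣≡k _ 𝓕 covering jumps =
  tokenJumps⇒auxPath G k (PrunedFamily k 𝓕 S T) (prunedFamily-covers G k S T 𝓕 covering)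
    ∣S∣≡k (inj₂ (inj₁ refl)) (λ x∈S → x∈S) (inj₂ (inj₂ refl)) jumps
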